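{- Let $I$ be an index set and suppose that for each $i\in I$, $X_i\times Y_i$ has the UU property. Then $\left(\prod_{i\in I}X_i\right)\times\left(\bigoplus_{i\in I}Y_i\right)$ has the UU property. In particular, if $2^\omega\times Y$ has the UU property, then $2^\omega\times(\omega\times Y)$ has the UU property.
   Context: $\prod_{i\in I}X_i$ carries the product topology and $\bigoplus_{i\in I}Y_i$ is the topological sum (disjoint clopen union) of the $Y_i$; $\omega$ is discrete. For topological spaces $X$ and $Y$, $X\times Y$ is said to have the UU (uniquely universal) property if there exists an open set $U\subseteq X\times Y$ such that for every open set $W\subseteq Y$ there is a unique $x\in X$ with $U_x=W$, where $U_x=\{y\in Y: (x,y)\in U\}$. -}

module Defs where

open import Level using (Level; 0ℓ; lift)
open import Data.Bool using (Bool)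
open import Data.Nat using (ℕ)
open import Data.Unit.Polymorphic using (⊤; tt)
open import Data.Product using (Σ; Σ-syntax; _×_; _,_; proj₁; proj₂)
open import Data.List using (List; []; _∷_; _++_)
open import Data.List.Relation.Unary.All using (All; []; _∷_)
open import Data.List.Relation.Unary.All.Properties using (++⁺; ++⁻ˡ; ++⁻ʳ)
open import Relation.Binary.PropositionalEquality using (_≡_; refl; sym; trans; subst)

Subset : Set → Set₁
Subset A = A → Set

_≐_ : {A : Set} → Subset A → Subset A → Set
P ≐ Q = ∀ a → (P a → Q a) × (Q a → P a)

-- Topological spaces (constructive rendering): a carrier with an
-- equivalence relation _≈_ playing the role of equality of points
-- (function extensionality is not available, so points of a product
-- cannot be compared with _≡_), and a family of open subsets closed
-- under the usual operations.

record Space : Set₂ where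
  field
    Carrier   : Set
    _≈_       : Carrier → Carrier → Set
    ≈-refl    : ∀ {a} → a ≈ a
    ≈-sym     : ∀ {a b} → a ≈ b → b ≈ a
    ≈-trans   : ∀ {a b c} → a ≈ b → b ≈ c → a ≈ c
    Open      : Subset Carrier → Set₁
    open-resp : ∀ {U} → Open U → ∀ {a b} → a ≈ b → U a → U b
    open-ext  : ∀ {U V} → U ≐ V → Open U → Open V
    open-univ : Open (λ _ → ⊤)
    open-∩    : ∀ {U V} → Open U → Open V → Open (λ a → U a × V a)
    open-⋃    : (J : Set) (F : J → Subset Carrier) →
                (∀ j → Open (F j)) → Open (λ a → Σ J (λ j → F j a))

open Space public

Discrete : Set → Space
Discrete A = record
  { Carrier = A ; _≈_ = _≡_ ; ≈-refl = refl ; ≈-sym = sym ; ≈-trans = trans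
  ; Open = λ _ → ⊤
  ; open-resp = λ {U} _ a≡b Ua → subst U a≡b Ua
  ; open-ext = λ _ _ → tt ; open-univ = tt ; open-∩ = λ _ _ → tt
  ; open-⋃ = λ _ _ _ → tt }

ω : Space
ω = Discrete ℕ

𝟚 : Space
𝟚 = Discrete Bool

module _ (X Y : Space) where
  private
    module X = Space X
    module Y = Space Y

  ProdCarrier : Set
  ProdCarrier = X.Carrier × Y.Carrier

  _≈×_ : ProdCarrier → ProdCarrier → Set
  p ≈× q = (proj₁ p X.≈ proj₁ q) × (proj₂ p Y.≈ proj₂ q)

  BoxNbhd : Subset ProdCarrier → ProdCarrier → Set₁
  BoxNbhd U p = Σ[ A ∈ Subset X.Carrier ] Σ[ B ∈ Subset Y.Carrier ]
      (X.Open A × Y.Open B × A (proj₁ p) × B (proj₂ p) ×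
       (∀ q → A (proj₁ q) → B (proj₂ q) → U q))

  OpenProd : Subset ProdCarrier → Set₁
  OpenProd U = (∀ {p q} → p ≈× q → U p → U q) × (∀ p → U p → BoxNbhd U p)

  _⊗_ : Space
  _⊗_ = record
    { Carrier = ProdCarrier ; _≈_ = _≈×_
    ; ≈-refl = X.≈-refl , Y.≈-refl
    ; ≈-sym = λ (a , b) → X.≈-sym a , Y.≈-sym b
    ; ≈-trans = λ (a , b) (c , d) → X.≈-trans a c , Y.≈-trans b d
    ; Open = OpenProd
    ; open-resp = λ o → proj₁ o
    ; open-ext = λ {U} {V} e o →
        (λ pq Vp → proj₁ (e _) (proj₁ o pq (proj₂ (e _) Vp)))
      , λ p Vp → let (A , B , oA , oB , Ap , Bp , sub) = proj₂ o p (proj₂ (e p) Vp)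
                 in A , B , oA , oB , Ap , Bp , λ q Aq Bq → proj₁ (e q) (sub q Aq Bq)
    ; open-univ = (λ _ _ → tt) , λ p _ → (λ _ → ⊤) , (λ _ → ⊤) , X.open-univ , Y.open-univ
                                         , tt , tt , λ _ _ _ → tt
    ; open-∩ = λ o o' →
        (λ pq (Up , Vp) → proj₁ o pq Up , proj₁ o' pq Vp)
      , λ p (Up , Vp) →
          let (A , B , oA , oB , Ap , Bp , sub) = proj₂ o p Up
              (A' , B' , oA' , oB' , Ap' , Bp' , sub') = proj₂ o' p Vp
          in (λ a → A a × A' a) , (λ b → B b × B' b) , X.open-∩ oA oA' , Y.open-∩ oB oB'
             , (Ap , Ap') , (Bp , Bp')
             , λ q (Aq , Aq') (Bq , Bq') → sub q Aq Bq , sub' q Aq' Bq'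
    ; open-⋃ = λ J F oF →
        (λ pq (j , Fp) → j , proj₁ (oF j) pq Fp)
      , λ p (j , Fp) →
          let (A , B , oA , oB , Ap , Bp , sub) = proj₂ (oF j) p Fp
          in A , B , oA , oB , Ap , Bp , λ q Aq Bq → j , sub q Aq Bq
    }

-- Product ∏_{i∈I} X_i with the product (Tychonoff) topology:
-- basic open sets are cylinders determined by finitely many
-- coordinates i₁,…,iₙ and open sets V_k ⊆ X_{i_k}; U is open iff it
-- respects ≈ and every point of U lies in a basic cylinder ⊆ U.

module _ (I : Set) (X : I → Space) where

  ΠCarrier : Set
  ΠCarrier = (i : I) → Carrier (X i)

  _≈Π_ : ΠCarrier → ΠCarrier → Set
  x ≈Π y = ∀ i → _≈_ (X i) (x i) (y i)

  Constraint : Set₁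
  Constraint = Σ[ i ∈ I ] Σ[ V ∈ Subset (Carrier (X i)) ] Open (X i) V

  Cyl : List Constraint → ΠCarrier → Set₁
  Cyl cs x = All (λ (i , V , _) → V (x i)) cs

  OpenΠ : Subset ΠCarrier → Set₁
  OpenΠ U = (∀ {x y} → x ≈Π y → U x → U y)
          × (∀ x → U x → Σ[ cs ∈ List Constraint ] (Cyl cs x × (∀ y → Cyl cs y → U y)))

  Π-space : Space
  Π-space = record
    { Carrier = ΠCarrier ; _≈_ = _≈Π_
    ; ≈-refl = λ i → ≈-refl (X i)
    ; ≈-sym = λ e i → ≈-sym (X i) (e i)
    ; ≈-trans = λ e f i → ≈-trans (X i) (e i) (f i)
    ; Open = OpenΠ
    ; open-resp = λ o → proj₁ o
    ; open-ext = λ e o →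
        (λ xy Vx → proj₁ (e _) (proj₁ o xy (proj₂ (e _) Vx)))
      , λ x Vx → let (cs , cx , sub) = proj₂ o x (proj₂ (e x) Vx)
                 in cs , cx , λ y cy → proj₁ (e y) (sub y cy)
    ; open-univ = (λ _ _ → tt) , λ x _ → [] , [] , λ _ _ → tt
    ; open-∩ = λ o o' →
        (λ xy (Ux , Vx) → proj₁ o xy Ux , proj₁ o' xy Vx)
      , λ x (Ux , Vx) →
          let (cs , cx , sub) = proj₂ o x Ux
              (cs' , cx' , sub') = proj₂ o' x Vx
          in cs ++ cs' , ++⁺ cx cx'
             , λ y cy → sub y (++⁻ˡ cs cy) , sub' y (++⁻ʳ cs cy)
    ; open-⋃ = λ J F oF →
        (λ xy (j , Fx) → j , proj₁ (oF j) xy Fx)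
      , λ x (j , Fx) → let (cs , cx , sub) = proj₂ (oF j) x Fx
                       in cs , cx , λ y cy → j , sub y cy
    }

  ΣCarrier : Set
  ΣCarrier = Σ[ i ∈ I ] Carrier (X i)

  data _≈Σ_ : ΣCarrier → ΣCarrier → Set where
    inj≈ : ∀ {i a b} → _≈_ (X i) a b → (i , a) ≈Σ (i , b)

  OpenΣ : Subset ΣCarrier → Set₁
  OpenΣ U = ∀ i → Open (X i) (λ a → U (i , a))

  ⊕-space : Space
  ⊕-space = record
    { Carrier = ΣCarrier ; _≈_ = _≈Σ_
    ; ≈-refl = inj≈ (≈-refl (X _))
    ; ≈-sym = λ { (inj≈ e) → inj≈ (≈-sym (X _) e) }
    ; ≈-trans = λ { (inj≈ e) (inj≈ f) → inj≈ (≈-trans (X _) e f) }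
    ; Open = OpenΣ
    ; open-resp = λ { o (inj≈ e) Ua → open-resp (X _) (o _) e Ua }
    ; open-ext = λ e o i → open-ext (X i) (λ a → e (i , a)) (o i)
    ; open-univ = λ i → open-univ (X i)
    ; open-∩ = λ o o' i → open-∩ (X i) (o i) (o' i)
    ; open-⋃ = λ J F oF i → open-⋃ (X i) J (λ j a → F j (i , a)) (λ j → oF j i)
    }

∏ : (I : Set) → (I → Space) → Space
∏ = Π-space

⊕ : (I : Set) → (I → Space) → Space
⊕ = ⊕-space

Cantor : Space
Cantor = ∏ ℕ (λ _ → 𝟚)

section : (X Y : Space) → Subset (Carrier (X ⊗ Y)) → Carrier X → Subset (Carrier Y)
section X Y U x y = U (x , y)

UU : Space → Space → Set₁
UU X Y = Σ[ U ∈ Subset (Carrier (X ⊗ Y)) ] (Open (X ⊗ Y) U ×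
           (∀ (W : Subset (Carrier Y)) → Open Y W →
              Σ[ x ∈ Carrier X ] (section X Y U x ≐ W ×
                 (∀ x' → section X Y U x' ≐ W → _≈_ X x' x))))

module Submission where

-- Given universal sets Uᵢ ⊆ X i × Y i, the set
--   𝕌 = {(x , (i , y)) | (x i , y) ∈ Uᵢ}
-- is open (a box A × B around (x i , y) in Uᵢ yields the box
-- π_i⁻¹(A) × (copy of B in the i-th summand) around the point in 𝕌), and
-- an open W ⊆ ⊕ Y i is the 𝕌-section at exactly the point x whose i-th
-- coordinate is the unique Uᵢ-witness for the slice W ∩ Y i.
--
-- The product theorem with X i = 2^ω, Y i = Y gives
-- UU (∏_ω 2^ω) (⊕_ω Y).  Two transport lemmas finish the proof: UU is
-- preserved by replacing the first factor along a continuous bijection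
-- 2^ω → ∏_ω 2^ω (regrouping coordinates along a pairing ℕ × ℕ ≅ ℕ), and
-- the second factor along a homeomorphism ω × Y ≅ ⊕_ω Y.

open import Defs
open import Data.Nat using (ℕ; zero; suc; _+_; pred)
open import Data.Nat.Properties using (+-suc; +-comm; +-identityʳ)
open import Data.Product using (Σ; Σ-syntax; _×_; _,_; proj₁; proj₂)
open import Data.List using (List; []; _∷_; _++_; map)
open import Data.List.Relation.Unary.All using ([]; _∷_)
open import Data.List.Relation.Unary.All.Properties using (++⁺; ++⁻ˡ; ++⁻ʳ; map⁺; map⁻)
open import Data.Unit.Polymorphic using (tt)
open import Relation.Binary.PropositionalEquality using (_≡_; refl; sym; trans; cong; module ≡-Reasoning)

Continuous : (X Y : Space) → (Carrier X → Carrier Y) → Set₁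
Continuous X Y f = ∀ {B} → Open Y B → Open X (λ a → B (f a))

record PointBijection (X Y : Space) : Set where
  field
    to        : Carrier X → Carrier Y
    from      : Carrier Y → Carrier X
    to-resp   : ∀ {a b} → _≈_ X a b → _≈_ Y (to a) (to b)
    from-resp : ∀ {a b} → _≈_ Y a b → _≈_ X (from a) (from b)
    from-to   : ∀ x → _≈_ X (from (to x)) x
    to-from   : ∀ y → _≈_ Y (to (from y)) y

open PointBijection

-- The first factor may be replaced along a continuous bijection X' → X:
-- pull the universal set back; the unique witness is carried back by the
-- inverse.
UU-transportˡ : {X' X Y : Space} (e : PointBijection X' X) →
                Continuous X' X (to e) → UU X Y → UU X' Y
UU-transportˡ {X'} {X} {Y} e to-cont (U , U-open , U-universal) =
  U' , U'-open , U'-universal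
  where
  U' : Subset (Carrier (X' ⊗ Y))
  U' (x' , y) = U (to e x' , y)

  U'-open : Open (X' ⊗ Y) U'
  U'-open =
      (λ (ex , ey) → proj₁ U-open (to-resp e ex , ey))
    , λ (x' , y) u → let (A , B , oA , oB , Ax , By , A×B⊆U) = proj₂ U-open (to e x' , y) u
                     in (λ a → A (to e a)) , B , to-cont oA , oB , Ax , By
                        , λ (q , y') Aq By' → A×B⊆U (to e q , y') Aq By'

  U'-universal : ∀ W → Open Y W →
    Σ[ x' ∈ Carrier X' ] (section X' Y U' x' ≐ W × (∀ z → section X' Y U' z ≐ W → _≈_ X' z x'))
  U'-universal W oW =
    let (x , Ux≐W , unique) = U-universal W oW
        same-section : section X Y U (to e (from e x)) ≐ section X Y U x
        same-section y = proj₁ U-open (to-from e x , ≈-refl Y)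
                       , proj₁ U-open (≈-sym X (to-from e x) , ≈-refl Y)
    in from e x
     , (λ y → (λ u → proj₁ (Ux≐W y) (proj₁ (same-section y) u))
            , (λ w → proj₂ (same-section y) (proj₂ (Ux≐W y) w)))
     , λ z Uz≐W → ≈-trans X' (≈-sym X' (from-to e z)) (from-resp e (unique (to e z) Uz≐W))

-- The second factor may be replaced along a homeomorphism Y' ≅ Y: pull the
-- universal set back along `to`, and find the witness for W ⊆ Y' as the
-- witness for its image (preimage under `from`) in Y.
UU-transportʳ : {X Y' Y : Space} (e : PointBijection Y' Y) →
                Continuous Y' Y (to e) → Continuous Y Y' (from e) →
                UU X Y → UU X Y'
UU-transportʳ {X} {Y'} {Y} e to-cont from-cont (U , U-open , U-universal) =
  U' , U'-open , U'-universal
  where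
  U' : Subset (Carrier (X ⊗ Y'))
  U' (x , y') = U (x , to e y')

  U'-open : Open (X ⊗ Y') U'
  U'-open =
      (λ (ex , ey) → proj₁ U-open (ex , to-resp e ey))
    , λ (x , y') u → let (A , B , oA , oB , Ax , By , A×B⊆U) = proj₂ U-open (x , to e y') u
                     in A , (λ b → B (to e b)) , oA , to-cont oB , Ax , By
                        , λ (q , b) Aq Bb → A×B⊆U (q , to e b) Aq Bb

  U'-universal : ∀ W → Open Y' W →
    Σ[ x ∈ Carrier X ] (section X Y' U' x ≐ W × (∀ z → section X Y' U' z ≐ W → _≈_ X z x))
  U'-universal W oW =
    let (x , Ux≐W∘from , unique) = U-universal (λ y → W (from e y)) (from-cont oW)
        W-back : ∀ y' → W (from e (to e y')) → W y'
        W-back y' = open-resp Y' oW (from-to e y')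
        W-forth : ∀ y' → W y' → W (from e (to e y'))
        W-forth y' = open-resp Y' oW (≈-sym Y' (from-to e y'))
    in x
     , (λ y' → (λ u → W-back y' (proj₁ (Ux≐W∘from (to e y')) u))
             , (λ w → proj₂ (Ux≐W∘from (to e y')) (W-forth y' w)))
     , λ z Uz≐W → unique z λ y →
         (λ u → proj₁ (Uz≐W (from e y)) (proj₁ U-open (≈-refl X , ≈-sym Y (to-from e y)) u))
       , (λ w → proj₁ U-open (≈-refl X , to-from e y) (proj₂ (Uz≐W (from e y)) w))

proj-continuous : {I : Set} (X : I → Space) (i : I) →
                  Continuous (∏ I X) (X i) (λ z → z i)
proj-continuous X i {A} oA =
    (λ e → open-resp (X i) oA (e i))
  , λ z Azi → ((i , A , oA) ∷ []) , (Azi ∷ []) , λ { _ (Az'i ∷ []) → Az'i }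

module _ {I : Set} (Y : I → Space) where

  Transported : {i j : I} → Subset (Carrier (Y i)) → i ≡ j → Subset (Carrier (Y j))
  Transported B refl = B

  inSummand : (i : I) → Subset (Carrier (Y i)) → Subset (ΣCarrier I Y)
  inSummand i B (j , y) = Σ (i ≡ j) (λ p → Transported B p y)

  -- Each summand is open in the sum: the copy of an open B is open, its
  -- slice at j being the union over the proofs of i ≡ j.
  inSummand-open : (i : I) {B : Subset (Carrier (Y i))} →
                   Open (Y i) B → Open (⊕ I Y) (inSummand i B)
  inSummand-open i {B} oB j = open-⋃ (Y j) (i ≡ j) (Transported B) Transported-open
    where
    Transported-open : (p : i ≡ j) → Open (Y j) (Transported B p)
    Transported-open refl = oB

-- Every slice {y | (x , y) ∈ W} of an open W ⊆ X × Y is open in Y: it is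
-- the union of the second sides of the boxes around its points.
slice-open : (X Y : Space) {W : Subset (Carrier (X ⊗ Y))} →
             Open (X ⊗ Y) W → (x : Carrier X) → Open Y (λ y → W (x , y))
slice-open X Y {W} oW x = open-ext Y union≐slice (open-⋃ Y Points Side Side-open)
  where
  Points : Set
  Points = Σ (Carrier Y) (λ y → W (x , y))

  box : (p : Points) → BoxNbhd X Y W (x , proj₁ p)
  box (y , w) = proj₂ oW (x , y) w

  Side : Points → Subset (Carrier Y)
  Side p = proj₁ (proj₂ (box p))

  Side-open : ∀ p → Open Y (Side p)
  Side-open p = let (_ , _ , _ , oB , _) = box p in oB

  union≐slice : (λ y → Σ Points (λ p → Side p y)) ≐ (λ y → W (x , y))
  union≐slice y =
      (λ (p , By) → let (_ , _ , _ , _ , Ax , _ , A×B⊆W) = box p in A×B⊆W (x , y) Ax By)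
    , λ w → (y , w) , (let (_ , _ , _ , _ , _ , By , _) = box (y , w) in By)

UU-product-sum : (I : Set) (X Y : I → Space) →
                 (∀ i → UU (X i) (Y i)) → UU (∏ I X) (⊕ I Y)
UU-product-sum I X Y uu = 𝕌 , 𝕌-open , 𝕌-universal
  where
  U : (i : I) → Subset (Carrier (X i ⊗ Y i))
  U i = proj₁ (uu i)

  U-open : (i : I) → Open (X i ⊗ Y i) (U i)
  U-open i = proj₁ (proj₂ (uu i))

  𝕌 : Subset (Carrier (∏ I X ⊗ ⊕ I Y))
  𝕌 (x , (i , y)) = U i (x i , y)

  𝕌-resp : ∀ {p q} → _≈_ (∏ I X ⊗ ⊕ I Y) p q → 𝕌 p → 𝕌 q
  𝕌-resp (ex , inj≈ {i} ey) = proj₁ (U-open i) (ex i , ey)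

  𝕌-box : ∀ p → 𝕌 p → BoxNbhd (∏ I X) (⊕ I Y) 𝕌 p
  𝕌-box (x , (i , y)) u =
    let (A , B , oA , oB , Axi , By , A×B⊆U) = proj₂ (U-open i) (x i , y) u
    in (λ z → A (z i)) , inSummand Y i B
     , proj-continuous X i oA , inSummand-open Y i oB
     , Axi , (refl , By)
     , λ { (z , (_ , y')) Azi (refl , By') → A×B⊆U (z i , y') Azi By' }

  𝕌-open : Open (∏ I X ⊗ ⊕ I Y) 𝕌
  𝕌-open = 𝕌-resp , 𝕌-box

  -- the unique Uᵢ-witness for the i-th slice of W, coordinate by coordinate
  𝕌-universal : ∀ W → Open (⊕ I Y) W →
    Σ[ x ∈ ΠCarrier I X ] (section (∏ I X) (⊕ I Y) 𝕌 x ≐ W ×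
                           (∀ z → section (∏ I X) (⊕ I Y) 𝕌 z ≐ W → _≈Π_ I X z x))
  𝕌-universal W oW =
      (λ i → proj₁ (witness i))
    , (λ (i , y) → proj₁ (proj₂ (witness i)) y)
    , λ z Uz≐W i → proj₂ (proj₂ (witness i)) (z i) (λ y → Uz≐W (i , y))
    where
    witness : (i : I) →
      Σ[ xᵢ ∈ Carrier (X i) ] (section (X i) (Y i) (U i) xᵢ ≐ (λ y → W (i , y)) ×
                               (∀ z → section (X i) (Y i) (U i) z ≐ (λ y → W (i , y)) → _≈_ (X i) z xᵢ))
    witness i = proj₂ (proj₂ (uu i)) (λ y → W (i , y)) (oW i)

-- Successor along the diagonals a + b = const, walked from (0 , s) to (s , 0).
next : ℕ × ℕ → ℕ × ℕ
next (a , zero)  = 0 , suc a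
next (a , suc b) = suc a , b

unpair : ℕ → ℕ × ℕ
unpair zero    = 0 , 0
unpair (suc n) = next (unpair n)

triangle : ℕ → ℕ
triangle zero    = 0
triangle (suc n) = suc n + triangle n

pair : ℕ → ℕ → ℕ
pair a b = triangle (a + b) + a

pair′ : ℕ × ℕ → ℕ
pair′ (a , b) = pair a b

pair-next : ∀ q → pair′ (next q) ≡ suc (pair′ q)
pair-next (a , zero) = cong suc (begin
  (a + triangle a) + 0 ≡⟨ +-identityʳ (a + triangle a) ⟩
  a + triangle a       ≡⟨ +-comm a (triangle a) ⟩
  triangle a + a       ≡⟨ cong (λ t → triangle t + a) (sym (+-identityʳ a)) ⟩
  triangle (a + 0) + a ∎)
  where open ≡-Reasoning
pair-next (a , suc b) = begin
  triangle (suc a + b) + suc a     ≡⟨ cong (λ t → triangle t + suc a) (sym (+-suc a b)) ⟩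
  triangle (a + suc b) + suc a     ≡⟨ +-suc (triangle (a + suc b)) a ⟩
  suc (triangle (a + suc b) + a)   ∎
  where open ≡-Reasoning

pair-unpair : ∀ n → pair′ (unpair n) ≡ n
pair-unpair zero    = refl
pair-unpair (suc n) = trans (pair-next (unpair n)) (cong suc (pair-unpair n))

unpair-onto : ∀ s a b → a + b ≡ s → Σ ℕ (λ n → unpair n ≡ (a , b))
unpair-onto s       zero    zero    _ = 0 , refl
unpair-onto s       (suc a) b       e =
  let (n , eq) = unpair-onto s a (suc b) (trans (+-suc a b) e) in suc n , cong next eq
unpair-onto (suc s) zero    (suc b) e =
  let (n , eq) = unpair-onto s b 0 (trans (+-identityʳ b) (cong pred e)) in suc n , cong next eq

unpair-pair : ∀ a b → unpair (pair a b) ≡ (a , b)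
unpair-pair a b with unpair-onto (a + b) a b refl
... | n , eq = begin
  unpair (pair′ (a , b))       ≡⟨ cong (λ q → unpair (pair′ q)) (sym eq) ⟩
  unpair (pair′ (unpair n))    ≡⟨ cong unpair (pair-unpair n) ⟩
  unpair n                     ≡⟨ eq ⟩
  (a , b)                      ∎
  where open ≡-Reasoning

module _ {I J K : Set} (X : I → Space) (σ : J → K → I) where

  regroup : ΠCarrier I X → ΠCarrier J (λ j → ∏ K (λ k → X (σ j k)))
  regroup x j k = x (σ j k)

  private
    Outer : Set₁
    Outer = Constraint J (λ j → ∏ K (λ k → X (σ j k)))

    Inner : Set₁
    Inner = Constraint I X

    relabel : (j : J) → Constraint K (λ k → X (σ j k)) → Inner
    relabel j (k , V , oV) = σ j k , V , oV

  -- A basic cylinder of the regrouped product contains a basic cylinder of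
  -- ∏ I X around any of its points: each outer constraint is open in
  -- ∏_K X (σ j k), so it contains a cylinder whose indices are relabelled by σ j.
  regroup-cylinder : (x : ΠCarrier I X) (cs : List Outer) →
    Cyl J (λ j → ∏ K (λ k → X (σ j k))) cs (regroup x) →
    Σ[ ds ∈ List Inner ] (Cyl I X ds x ×
      (∀ y → Cyl I X ds y → Cyl J (λ j → ∏ K (λ k → X (σ j k))) cs (regroup y)))
  regroup-cylinder x []                   []         = [] , [] , λ _ _ → []
  regroup-cylinder x ((j , V , oV) ∷ cs) (Vx ∷ csx) =
    let (ds , dsx , ds⊆V)    = proj₂ oV (regroup x j) Vx
        (es , esx , es⊆cs)   = regroup-cylinder x cs csx
        ds′                  = map (relabel j) ds
    in ds′ ++ es , ++⁺ (map⁺ dsx) esx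
     , λ y c → ds⊆V (regroup y j) (map⁻ (++⁻ˡ ds′ c)) ∷ es⊆cs y (++⁻ʳ ds′ c)

  regroup-continuous : Continuous (∏ I X) (∏ J (λ j → ∏ K (λ k → X (σ j k)))) regroup
  regroup-continuous oA =
      (λ e → proj₁ oA (λ j k → e (σ j k)))
    , λ x Ax → let (cs , csx , cs⊆A) = proj₂ oA (regroup x) Ax
                   (ds , dsx , ds⊆cs) = regroup-cylinder x cs csx
               in ds , dsx , λ y c → cs⊆A (regroup y) (ds⊆cs y c)

Cantor≅Cantorʷ : PointBijection Cantor (∏ ℕ (λ _ → Cantor))
Cantor≅Cantorʷ = record
  { to        = regroup (λ _ → 𝟚) pair
  ; from      = λ z n → z (proj₁ (unpair n)) (proj₂ (unpair n))
  ; to-resp   = λ e j k → e (pair j k)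
  ; from-resp = λ e n → e (proj₁ (unpair n)) (proj₂ (unpair n))
  ; from-to   = λ x n → cong x (pair-unpair n)
  ; to-from   = λ z j k → cong (λ q → z (proj₁ q) (proj₂ q)) (unpair-pair j k)
  }

module _ (D : Set) (Y : Space) where

  discrete⊗≅⊕ : PointBijection (Discrete D ⊗ Y) (⊕ D (λ _ → Y))
  discrete⊗≅⊕ = record
    { to        = λ p → p
    ; from      = λ p → p
    ; to-resp   = λ { (refl , e) → inj≈ e }
    ; from-resp = λ { (inj≈ e) → refl , e }
    ; from-to   = λ _ → refl , ≈-refl Y
    ; to-from   = λ _ → inj≈ (≈-refl Y)
    }

  -- an open B ⊆ ⊕ is open in D × Y: around (d , y) take the box {d} × B_d
  discrete⊗→⊕-continuous : Continuous (Discrete D ⊗ Y) (⊕ D (λ _ → Y)) (to discrete⊗≅⊕)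
  discrete⊗→⊕-continuous {B} oB =
      (λ { {d , _} (refl , e) → open-resp Y (oB d) e })
    , λ (d , y) By → (λ d' → d' ≡ d) , (λ y' → B (d , y')) , tt , oB d , refl , By
                   , λ { (_ , y') refl By' → By' }

  -- an open W ⊆ D × Y is open in ⊕: its summands are its slices
  ⊕→discrete⊗-continuous : Continuous (⊕ D (λ _ → Y)) (Discrete D ⊗ Y) (from discrete⊗≅⊕)
  ⊕→discrete⊗-continuous oW = slice-open (Discrete D) Y oW

proposition29 : ((I : Set) (X Y : I → Space) →
    (∀ i → UU (X i) (Y i)) → UU (∏ I X) (⊕ I Y))
    × ((Y : Space) → UU Cantor Y → UU Cantor (ω ⊗ Y))
proposition29 = UU-product-sum , cantor-case
  where
  cantor-case : (Y : Space) → UU Cantor Y → UU Cantor (ω ⊗ Y)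
  cantor-case Y uu =
    UU-transportʳ {Cantor} (discrete⊗≅⊕ ℕ Y) (discrete⊗→⊕-continuous ℕ Y) (⊕→discrete⊗-continuous ℕ Y)
      (UU-transportˡ {Y = ⊕ ℕ (λ _ → Y)} Cantor≅Cantorʷ (regroup-continuous (λ _ → 𝟚) pair)
        (UU-product-sum ℕ (λ _ → Cantor) (λ _ → Y) (λ _ → uu)))
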